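{- (Derived rule Back-Var-Matched.) Let $R(n)$, $n\in\mathbb{N}$, be a family of binary relations on IMP states, $S$ a binary relation on states, $b,b'$ boolean expressions and $c,c'$ IMP commands. If for every $n\in\mathbb{N}$ the judgement $\vdash\langle R(n)\land b^1\land b'^2\rangle\ c,\ c'\ \langle R(n+1)\rangle$ is derivable, and $\vdash\langle \exists n.R(n)\rangle\ \mathbf{while}\ b\ \mathbf{do}\ c,\ \mathbf{while}\ b'\ \mathbf{do}\ c'\ \langle S\rangle$ is derivable, then $\vdash\langle R(0)\rangle\ \mathbf{while}\ b\ \mathbf{do}\ c,\ \mathbf{while}\ b'\ \mathbf{do}\ c'\ \langle S\rangle$ is derivable.
   Context: IMP commands: $c ::= x := e \mid c;c \mid \mathbf{if}\ b\ \mathbf{then}\ c\ \mathbf{else}\ c \mid \mathbf{while}\ b\ \mathbf{do}\ c \mid \mathbf{skip}$, where $x$ ranges over program variables, $e$ over integer arithmetic expressions and $b$ over boolean expressions. A state $s$ maps variables to integers; $[e]_s$, $[b]_s$ denote evaluation in $s$, and $s(x:=v)$ is $s$ updated at $x$. $(c,s)\Rightarrow t$ is the standard big-step semantics of IMP. Relations are binary relations on states. Notation: $R\land S$, $R\lor S$ pointwise; $b^1 \equiv \lambda s\,s'.\,[b]_s$ and $b^2 \equiv \lambda s\,s'.\,[b]_{s'}$; $\exists n.R(n)\equiv\lambda s\,s'.\,\exists n.\,R(n)(s,s')$; $R\implies S$ means $R\subseteq S$; $\overleftrightarrow{R}\equiv\lambda s\,s'.\,R(s',s)$; $R[x:=e]\equiv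 \lambda s\,s'.\ \exists v.\ R(s(x:=v),s')\land s(x)=[e]_{s(x:=v)}$. The judgement $\vdash\langle R\rangle\ c,\ c'\ \langle S\rangle$ is inductively defined by the rules: (Skip) if $\forall t\,t'.\ S(t,t')\implies\exists s'.\ R(t,s')\land (c',s')\Rightarrow t'$ then $\vdash\langle R\rangle\ \mathbf{skip},\ c'\ \langle S\rangle$; (Seq1) from $\vdash\langle R\rangle\ c,\ c'\ \langle S\rangle$ and $\vdash\langle S\rangle\ d,\ \mathbf{skip}\ \langle T\rangle$ infer $\vdash\langle R\rangle\ (c;d),\ c'\ \langle T\rangle$; (Assign) from $\vdash\langle R[x:=e]\rangle\ \mathbf{skip},\ c'\ \langle S\rangle$ infer $\vdash\langle R\rangle\ x:=e,\ c'\ \langle S\rangle$; (IfTrue) from $\vdash\langle R\land b^1\rangle\ c_1,\ c'\ \langle S\rangle$ infer $\vdash\langle R\rangle\ \mathbf{if}\ b\ \mathbf{then}\ c_1\ \mathbf{else}\ c_2,\ c'\ \langle S\rangle$; (IfFalse) from $\vdash\langle R\land (\lnot b)^1\rangle\ c_2,\ c'\ \langle S\rangle$ infer the same conclusion; (WhileFalse) from $\vdash\langle R\land(\lnot b)^1\rangle\ \mathbf{skip},\ c'\ \langle S\rangle$ infer $\vdash\langle R\rangle\ \mathbf{while}\ b\ \mathbf{do}\ c,\ c'\ \langle S\rangle$; (WhileTrue) from $\vdash\langle R\land b^1\rangle\ (c;\mathbf{while}\ b\ \mathbf{do}\ c),\ c'\ \langle S\rangle$ infer $\vdash\langle R\rangle\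 \mathbf{while}\ b\ \mathbf{do}\ c,\ c'\ \langle S\rangle$; (Back-Var) from $\forall n.\ \vdash\langle R(n)\land b^1\rangle\ c,\ \mathbf{skip}\ \langle R(n+1)\rangle$ and $\vdash\langle \exists n.R(n)\rangle\ \mathbf{while}\ b\ \mathbf{do}\ c,\ c'\ \langle S\rangle$ infer $\vdash\langle R(0)\rangle\ \mathbf{while}\ b\ \mathbf{do}\ c,\ c'\ \langle S\rangle$; (Conseq) from $R_1\implies R_2$, $\vdash\langle R_1\rangle\ c,\ c'\ \langle S_1\rangle$ and $S_2\implies S_1$ infer $\vdash\langle R_2\rangle\ c,\ c'\ \langle S_2\rangle$; (Disj) from $\vdash\langle R_1\rangle\ c,\ c'\ \langle S_1\rangle$ and $\vdash\langle R_2\rangle\ c,\ c'\ \langle S_2\rangle$ infer $\vdash\langle R_1\lor R_2\rangle\ c,\ c'\ \langle S_1\lor S_2\rangle$; (Sym) from $\vdash\langle \overleftrightarrow{R}\rangle\ c',\ c\ \langle \overleftrightarrow{S}\rangle$ infer $\vdash\langle R\rangle\ c,\ c'\ \langle S\rangle$. -}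

module Defs where

open import Data.Nat using (ℕ; zero; suc)
open import Data.Nat.Properties using (_≟_)
open import Data.Integer using (ℤ; _+_; _<_; _<?_)
open import Data.Bool using (Bool; true; false; not; _∧_; if_then_else_)
open import Data.Product using (Σ; ∃; _×_; _,_)
open import Data.Sum using (_⊎_)
open import Relation.Nullary.Decidable using (⌊_⌋; does)
open import Relation.Binary.PropositionalEquality using (_≡_)

-- Program variables (names). Any type with decidable equality works; we use ℕ.
Vname : Set
Vname = ℕ

State : Set
State = Vname → ℤ

data AExp : Set where
  N    : ℤ → AExp
  V    : Vname → AExp
  Plus : AExp → AExp → AExp

aval : AExp → State → ℤ
aval (N n) s = n
aval (V x) s = s x
aval (Plus a₁ a₂) s = aval a₁ s + aval a₂ s

data BExp : Set where
  Bc   : Bool → BExp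
  Not  : BExp → BExp
  And  : BExp → BExp → BExp
  Less : AExp → AExp → BExp

bval : BExp → State → Bool
bval (Bc v) s = v
bval (Not b) s = not (bval b s)
bval (And b₁ b₂) s = bval b₁ s ∧ bval b₂ s
bval (Less a₁ a₂) s = does (aval a₁ s <? aval a₂ s)

data Com : Set where
  SKIP   : Com
  _::=_  : Vname → AExp → Com
  _⨾_    : Com → Com → Com
  IF_THEN_ELSE_ : BExp → Com → Com → Com
  WHILE_DO_ : BExp → Com → Com

_[_↦_] : State → Vname → ℤ → State
(s [ x ↦ v ]) y = if does (y ≟ x) then v else s y

data _⊢_⇒_ : Com → State → State → Set where
  Skip      : ∀ {s} → SKIP ⊢ s ⇒ s
  Assign    : ∀ {x a s} → (x ::= a) ⊢ s ⇒ (s [ x ↦ aval a s ])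
  Seq       : ∀ {c₁ c₂ s₁ s₂ s₃} → c₁ ⊢ s₁ ⇒ s₂ → c₂ ⊢ s₂ ⇒ s₃ → (c₁ ⨾ c₂) ⊢ s₁ ⇒ s₃
  IfTrue    : ∀ {b c₁ c₂ s t} → bval b s ≡ true → c₁ ⊢ s ⇒ t → (IF b THEN c₁ ELSE c₂) ⊢ s ⇒ t
  IfFalse   : ∀ {b c₁ c₂ s t} → bval b s ≡ false → c₂ ⊢ s ⇒ t → (IF b THEN c₁ ELSE c₂) ⊢ s ⇒ t
  WhileFalse : ∀ {b c s} → bval b s ≡ false → (WHILE b DO c) ⊢ s ⇒ s
  WhileTrue : ∀ {b c s₁ s₂ s₃} → bval b s₁ ≡ true → c ⊢ s₁ ⇒ s₂ →
              (WHILE b DO c) ⊢ s₂ ⇒ s₃ → (WHILE b DO c) ⊢ s₁ ⇒ s₃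

Rel : Set₁
Rel = State → State → Set

_∧ᴿ_ : Rel → Rel → Rel
(R ∧ᴿ S) s s' = R s s' × S s s'

_∨ᴿ_ : Rel → Rel → Rel
(R ∨ᴿ S) s s' = R s s' ⊎ S s s'

_¹ : BExp → Rel
(b ¹) s s' = bval b s ≡ true

_² : BExp → Rel
(b ²) s s' = bval b s' ≡ true

∃ᴿ : (ℕ → Rel) → Rel
∃ᴿ R s s' = Σ ℕ (λ n → R n s s')

_⟹_ : Rel → Rel → Set
R ⟹ S = ∀ s s' → R s s' → S s s'

flip : Rel → Rel
flip R s s' = R s' s

_[_:=_]ᴿ : Rel → Vname → AExp → Rel
(R [ x := e ]ᴿ) s s' = Σ ℤ (λ v → R (s [ x ↦ v ]) s' × s x ≡ aval e (s [ x ↦ v ]))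

data ⊢⟨_⟩_,_⟨_⟩ : Rel → Com → Com → Rel → Set₁ where
  skipR    : ∀ {R c' S} →
             (∀ t t' → S t t' → Σ State (λ s' → R t s' × c' ⊢ s' ⇒ t')) →
             ⊢⟨ R ⟩ SKIP , c' ⟨ S ⟩
  seq1     : ∀ {R S T c d c'} → ⊢⟨ R ⟩ c , c' ⟨ S ⟩ → ⊢⟨ S ⟩ d , SKIP ⟨ T ⟩ →
             ⊢⟨ R ⟩ (c ⨾ d) , c' ⟨ T ⟩
  assign   : ∀ {R S x e c'} → ⊢⟨ R [ x := e ]ᴿ ⟩ SKIP , c' ⟨ S ⟩ →
             ⊢⟨ R ⟩ (x ::= e) , c' ⟨ S ⟩
  ifTrue   : ∀ {R S b c₁ c₂ c'} → ⊢⟨ R ∧ᴿ (b ¹) ⟩ c₁ , c' ⟨ S ⟩ →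
             ⊢⟨ R ⟩ (IF b THEN c₁ ELSE c₂) , c' ⟨ S ⟩
  ifFalse  : ∀ {R S b c₁ c₂ c'} → ⊢⟨ R ∧ᴿ ((Not b) ¹) ⟩ c₂ , c' ⟨ S ⟩ →
             ⊢⟨ R ⟩ (IF b THEN c₁ ELSE c₂) , c' ⟨ S ⟩
  whileFalse : ∀ {R S b c c'} → ⊢⟨ R ∧ᴿ ((Not b) ¹) ⟩ SKIP , c' ⟨ S ⟩ →
             ⊢⟨ R ⟩ (WHILE b DO c) , c' ⟨ S ⟩
  whileTrue : ∀ {R S b c c'} → ⊢⟨ R ∧ᴿ (b ¹) ⟩ (c ⨾ (WHILE b DO c)) , c' ⟨ S ⟩ →
             ⊢⟨ R ⟩ (WHILE b DO c) , c' ⟨ S ⟩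
  backVar  : ∀ {R : ℕ → Rel} {S b c c'} →
             (∀ n → ⊢⟨ R n ∧ᴿ (b ¹) ⟩ c , SKIP ⟨ R (suc n) ⟩) →
             ⊢⟨ ∃ᴿ R ⟩ (WHILE b DO c) , c' ⟨ S ⟩ →
             ⊢⟨ R 0 ⟩ (WHILE b DO c) , c' ⟨ S ⟩
  conseq   : ∀ {R₁ R₂ S₁ S₂ c c'} → R₁ ⟹ R₂ → ⊢⟨ R₁ ⟩ c , c' ⟨ S₁ ⟩ → S₂ ⟹ S₁ →
             ⊢⟨ R₂ ⟩ c , c' ⟨ S₂ ⟩
  disj     : ∀ {R₁ R₂ S₁ S₂ c c'} → ⊢⟨ R₁ ⟩ c , c' ⟨ S₁ ⟩ → ⊢⟨ R₂ ⟩ c , c' ⟨ S₂ ⟩ →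
             ⊢⟨ R₁ ∨ᴿ R₂ ⟩ c , c' ⟨ S₁ ∨ᴿ S₂ ⟩
  sym      : ∀ {R S c c'} → ⊢⟨ flip R ⟩ c' , c ⟨ flip S ⟩ → ⊢⟨ R ⟩ c , c' ⟨ S ⟩

-- Read ⊢⟨ R ⟩ c , c' ⟨ S ⟩ as: every S-pair of final states is reached by running c and c'
-- from some R-pair of initial states. The rules are sound for this reading, and complete
-- for judgements with SKIP on one side; Back-Var, with the invariant "n guarded iterations
-- of the body away from an R-pair", extends completeness to a loop facing any command that
-- is itself complete against SKIP. Back-Var-Matched is valid: applying the premise n times
-- turns an R n-pair entering both loops into an R 0-pair, adding one iteration to each
-- loop per step. Completeness then derives the conclusion.
module Submission where

open import Defs
open import Data.Nat using (ℕ; suc; zero)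
open import Data.Integer using (ℤ)
open import Data.Bool using (true; false; not)
open import Data.Bool.Properties using (not-injective)
open import Data.Product using (Σ; _×_; _,_)
open import Data.Sum using (inj₁; inj₂; reduce)
open import Relation.Binary.PropositionalEquality using (_≡_; refl; cong)

-- Big-step semantics in which an assignment may also be read backwards, from t [ x ↦ v ]
-- to t. Without function extensionality the state (t [ x ↦ v ]) [ x ↦ aval a (t [ x ↦ v ]) ]
-- is not provably equal to t, so the assign rule is only sound for this variant.
data _⊢_⇓_ : Com → State → State → Set where
  skip       : ∀ {s} → SKIP ⊢ s ⇓ s
  assign     : ∀ {x a s} → (x ::= a) ⊢ s ⇓ (s [ x ↦ aval a s ])
  assign⁻¹   : ∀ {x a t} (v : ℤ) → t x ≡ aval a (t [ x ↦ v ]) → (x ::= a) ⊢ (t [ x ↦ v ]) ⇓ t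
  seq        : ∀ {c₁ c₂ s₁ s₂ s₃} → c₁ ⊢ s₁ ⇓ s₂ → c₂ ⊢ s₂ ⇓ s₃ → (c₁ ⨾ c₂) ⊢ s₁ ⇓ s₃
  ifTrue     : ∀ {b c₁ c₂ s t} → bval b s ≡ true → c₁ ⊢ s ⇓ t → (IF b THEN c₁ ELSE c₂) ⊢ s ⇓ t
  ifFalse    : ∀ {b c₁ c₂ s t} → bval b s ≡ false → c₂ ⊢ s ⇓ t → (IF b THEN c₁ ELSE c₂) ⊢ s ⇓ t
  whileFalse : ∀ {b c s} → bval b s ≡ false → (WHILE b DO c) ⊢ s ⇓ s
  whileTrue  : ∀ {b c s₁ s₂ s₃} → bval b s₁ ≡ true → c ⊢ s₁ ⇓ s₂ →
               (WHILE b DO c) ⊢ s₂ ⇓ s₃ → (WHILE b DO c) ⊢ s₁ ⇓ s₃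

⇒⇒⇓ : ∀ {c s t} → c ⊢ s ⇒ t → c ⊢ s ⇓ t
⇒⇒⇓ Skip              = skip
⇒⇒⇓ Assign            = assign
⇒⇒⇓ (Seq p q)         = seq (⇒⇒⇓ p) (⇒⇒⇓ q)
⇒⇒⇓ (IfTrue b p)      = ifTrue b (⇒⇒⇓ p)
⇒⇒⇓ (IfFalse b p)     = ifFalse b (⇒⇒⇓ p)
⇒⇒⇓ (WhileFalse b)    = whileFalse b
⇒⇒⇓ (WhileTrue b p q) = whileTrue b (⇒⇒⇓ p) (⇒⇒⇓ q)

Reaches : Rel → Com → Com → State → State → Set
Reaches R c c' t t' = Σ State λ s → Σ State λ s' → R s s' × c ⊢ s ⇓ t × c' ⊢ s' ⇓ t'

⊨⟨_⟩_,_⟨_⟩ : Rel → Com → Com → Rel → Set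
⊨⟨ R ⟩ c , c' ⟨ S ⟩ = ∀ t t' → S t t' → Reaches R c c' t t'

⊨-flip : ∀ {R S c c'} → ⊨⟨ R ⟩ c , c' ⟨ S ⟩ → ⊨⟨ flip R ⟩ c' , c ⟨ flip S ⟩
⊨-flip h t' t st with h t t' st
... | s , s' , r , e , e' = s' , s , r , e' , e

descend : ∀ {P : ℕ → Set} → (∀ n → P (suc n) → P n) → ∀ n → P n → P 0
descend step zero    p = p
descend step (suc n) p = descend step n (step n p)

not≡true⇒≡false : ∀ {x} → not x ≡ true → x ≡ false
not≡true⇒≡false = not-injective

sound : ∀ {R c c' S} → ⊢⟨ R ⟩ c , c' ⟨ S ⟩ → ⊨⟨ R ⟩ c , c' ⟨ S ⟩
sound (skipR h) t t' st with h t t' st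
... | s' , r , run = t , s' , r , skip , ⇒⇒⇓ run
sound (seq1 d₁ d₂) t t' st with sound d₂ t t' st
... | u , .t' , su , e₂ , skip with sound d₁ u t' su
... | s , s' , r , e₁ , e' = s , s' , r , seq e₁ e₂ , e'
sound (assign d) t t' st with sound d t t' st
... | .t , s' , (v , r , eq) , skip , e' = _ , s' , r , assign⁻¹ v eq , e'
sound (ifTrue d) t t' st with sound d t t' st
... | s , s' , (r , bt) , e , e' = s , s' , r , ifTrue bt e , e'
sound (ifFalse d) t t' st with sound d t t' st
... | s , s' , (r , nb) , e , e' = s , s' , r , ifFalse (not≡true⇒≡false nb) e , e'
sound (whileFalse d) t t' st with sound d t t' st
... | .t , s' , (r , nb) , skip , e' = t , s' , r , whileFalse (not≡true⇒≡false nb) , e'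
sound (whileTrue d) t t' st with sound d t t' st
... | s , s' , (r , bt) , seq e₁ e₂ , e' = s , s' , r , whileTrue bt e₁ e₂ , e'
sound {c' = c'} (backVar {R = R} {b = b} {c = c} body d) t t' st with sound d t t' st
... | s , s' , (n , r) , e , e' = descend unfold n (s , s' , r , e , e')
  where
  unfold : ∀ n → Reaches (R (suc n)) (WHILE b DO c) c' t t' → Reaches (R n) (WHILE b DO c) c' t t'
  unfold n (s , s' , r , e , e') with sound (body n) s s' r
  ... | u , .s' , (r₀ , bt) , ec , skip = u , s' , r₀ , whileTrue bt ec e , e'
sound (conseq r₁₂ d s₂₁) t t' st with sound d t t' (s₂₁ t t' st)
... | s , s' , r , e , e' = s , s' , r₁₂ s s' r , e , e'
sound (disj d₁ d₂) t t' (inj₁ st) with sound d₁ t t' st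
... | s , s' , r , e , e' = s , s' , inj₁ r , e , e'
sound (disj d₁ d₂) t t' (inj₂ st) with sound d₂ t t' st
... | s , s' , r , e , e' = s , s' , inj₂ r , e , e'
sound (sym d) = ⊨-flip (sound d)

data Iter (b : BExp) (c : Com) : ℕ → State → State → Set where
  done : ∀ {s} → Iter b c 0 s s
  snoc : ∀ {n s u t} → Iter b c n s u → bval b u ≡ true → c ⊢ u ⇓ t → Iter b c (suc n) s t

Iter-cons : ∀ {b c n s u t} → bval b s ≡ true → c ⊢ s ⇓ u → Iter b c n u t → Iter b c (suc n) s t
Iter-cons bt ec done            = snoc done bt ec
Iter-cons bt ec (snoc it bu eu) = snoc (Iter-cons bt ec it) bu eu

while⇓⇒Iter : ∀ {b c s t} → (WHILE b DO c) ⊢ s ⇓ t → Σ ℕ λ n → Iter b c n s t × bval b t ≡ false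
while⇓⇒Iter (whileFalse bf) = 0 , done , bf
while⇓⇒Iter (whileTrue bt e₁ e₂) with while⇓⇒Iter e₂
... | n , it , bf = suc n , Iter-cons bt e₁ it , bf

⊢-split : ∀ {R S S₁ S₂ c c'} → ⊢⟨ R ⟩ c , c' ⟨ S₁ ⟩ → ⊢⟨ R ⟩ c , c' ⟨ S₂ ⟩ →
          S ⟹ (S₁ ∨ᴿ S₂) → ⊢⟨ R ⟩ c , c' ⟨ S ⟩
⊢-split d₁ d₂ split = conseq (λ _ _ → reduce) (disj d₁ d₂) split

Complete : Com → Com → Set₁
Complete c c' = ∀ {R S} → ⊨⟨ R ⟩ c , c' ⟨ S ⟩ → ⊢⟨ R ⟩ c , c' ⟨ S ⟩

complete-flip : ∀ {c c'} → Complete c' c → Complete c c'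
complete-flip complete h = sym (complete (⊨-flip h))

complete-while : ∀ {b c c'} → Complete c SKIP → Complete SKIP c' → Complete (WHILE b DO c) c'
complete-while {b} {c} {c'} complete-body complete-exit {R} {S} h =
  conseq {R₁ = Q 0} Q0⟹R (backVar {R = Q} body exit) (λ _ _ st → st)
  where
  Q : ℕ → Rel
  Q n t u = Σ State λ s → R s u × Iter b c n s t
  Q0⟹R : Q 0 ⟹ R
  Q0⟹R t u (.t , r , done) = r
  body : ∀ n → ⊢⟨ Q n ∧ᴿ (b ¹) ⟩ c , SKIP ⟨ Q (suc n) ⟩
  body n = complete-body λ where
    t t' (s , r , snoc {u = u} it bu eu) → u , t' , ((s , r , it) , bu) , eu , skip
  exit : ⊢⟨ ∃ᴿ Q ⟩ (WHILE b DO c) , c' ⟨ S ⟩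
  exit = whileFalse (complete-exit λ t t' st → reached (h t t' st))
    where
    reached : ∀ {t t'} → Reaches R (WHILE b DO c) c' t t' → Reaches (∃ᴿ Q ∧ᴿ ((Not b) ¹)) SKIP c' t t'
    reached (s , s' , r , e , e') with while⇓⇒Iter e
    ... | n , it , bf = _ , s' , ((n , s , r , it) , cong not bf) , skip , e'

complete-skip : Complete SKIP SKIP
complete-skip h = skipR λ t t' st → case (h t t' st)
  where
  case : ∀ {R t t'} → Reaches R SKIP SKIP t t' → Σ State λ s' → R t s' × SKIP ⊢ s' ⇒ t'
  case (_ , _ , r , skip , skip) = _ , r , Skip

complete : ∀ c → Complete c SKIP
complete SKIP = complete-skip
complete (x ::= a) {R} {S} h = ⊢-split forwards backwards split
  where
  Forwards Backwards : Rel
  Forwards t t' = Σ State λ s → R s t' × t ≡ s [ x ↦ aval a s ]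
  Backwards t t' = Σ ℤ λ v → R (t [ x ↦ v ]) t' × t x ≡ aval a (t [ x ↦ v ])
  forwards : ⊢⟨ R ⟩ (x ::= a) , SKIP ⟨ Forwards ⟩
  forwards = sym (skipR λ where t .(s [ x ↦ aval a s ]) (s , r , refl) → s , r , Assign)
  backwards : ⊢⟨ R ⟩ (x ::= a) , SKIP ⟨ Backwards ⟩
  backwards = assign (skipR λ t t' st → t' , st , Skip)
  split : S ⟹ (Forwards ∨ᴿ Backwards)
  split t t' st with h t t' st
  ... | s , _ , r , assign , skip        = inj₁ (s , r , refl)
  ... | _ , _ , r , assign⁻¹ v eq , skip = inj₂ (v , r , eq)
complete (c₁ ⨾ c₂) {R} {S} h = seq1 (complete c₁ λ u t' m → m) (complete c₂ second)
  where
  Mid : Rel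
  Mid u t' = Reaches R c₁ SKIP u t'
  second : ⊨⟨ Mid ⟩ c₂ , SKIP ⟨ S ⟩
  second t t' st with h t t' st
  ... | s , s' , r , seq {s₂ = u} e₁ e₂ , e' = u , t' , (s , s' , r , e₁ , e') , e₂ , skip
complete (IF b THEN c₁ ELSE c₂) {R} {S} h =
  ⊢-split (ifTrue (complete c₁ thenBranch)) (ifFalse (complete c₂ elseBranch)) split
  where
  Then Else : Rel
  Then t t' = Reaches (R ∧ᴿ (b ¹)) c₁ SKIP t t'
  Else t t' = Reaches (R ∧ᴿ ((Not b) ¹)) c₂ SKIP t t'
  thenBranch : ⊨⟨ R ∧ᴿ (b ¹) ⟩ c₁ , SKIP ⟨ Then ⟩
  thenBranch t t' reach = reach
  elseBranch : ⊨⟨ R ∧ᴿ ((Not b) ¹) ⟩ c₂ , SKIP ⟨ Else ⟩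
  elseBranch t t' reach = reach
  split : S ⟹ (Then ∨ᴿ Else)
  split t t' st with h t t' st
  ... | s , s' , r , ifTrue bt e , e'  = inj₁ (s , s' , (r , bt) , e , e')
  ... | s , s' , r , ifFalse bf e , e' = inj₂ (s , s' , (r , cong not bf) , e , e')
complete (WHILE b DO c) = complete-while (complete c) complete-skip

mainTheorem7 : (R : ℕ → Rel) (S : Rel) (b b' : BExp) (c c' : Com) →
    (∀ n → ⊢⟨ (R n ∧ᴿ (b ¹)) ∧ᴿ (b' ²) ⟩ c , c' ⟨ R (suc n) ⟩) →
    ⊢⟨ ∃ᴿ R ⟩ (WHILE b DO c) , (WHILE b' DO c') ⟨ S ⟩ →
    ⊢⟨ R 0 ⟩ (WHILE b DO c) , (WHILE b' DO c') ⟨ S ⟩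
mainTheorem7 R S b b' c c' body loops =
  complete-while (complete c) (complete-flip (complete (WHILE b' DO c'))) valid
  where
  unfold : ∀ {t t'} n → Reaches (R (suc n)) (WHILE b DO c) (WHILE b' DO c') t t' →
           Reaches (R n) (WHILE b DO c) (WHILE b' DO c') t t'
  unfold n (s , s' , r , e , e') with sound (body n) s s' r
  ... | u , u' , ((r₀ , bt) , bt') , ec , ec' = u , u' , r₀ , whileTrue bt ec e , whileTrue bt' ec' e'
  valid : ⊨⟨ R 0 ⟩ (WHILE b DO c) , (WHILE b' DO c') ⟨ S ⟩
  valid t t' st with sound loops t t' st
  ... | s , s' , (n , r) , e , e' = descend unfold n (s , s' , r , e , e')
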